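{- Let $F$ be a field, let $n\ge d\ge 2$, and let $H$ be a $d$-uniform hypergraph on $n$ vertices. Then $\mathrm{M}(H)\le \mathrm{Z}_0(H)$.
   Context: A $d$-uniform hypergraph ($d$-hypergraph) $H$ has vertex set $V(H)$ (here identified with $[n]=\{1,\dots,n\}$) and edge set $E(H)$ consisting of $d$-element subsets of $V(H)$. Maximum nullity: a $d$-hypermatrix $A=[a_{i_1\cdots i_d}]\in F^{n\times\cdots\times n}$ is graphical if it is symmetric ($a_{i_{\pi(1)}\cdots i_{\pi(d)}}=a_{i_1\cdots i_d}$ for all permutations $\pi$) and $a_{i_1\cdots i_d}=0$ whenever $i_1,\dots,i_d$ are not all distinct. $\mathcal{S}(H)$ is the set of graphical $A$ with $a_{i_1\cdots i_d}\ne 0$ if and only if $\{i_1,\dots,i_d\}\in E(H)$. A vector $x\in F^n$ is a null vector of $A$ if $\sum_{j=1}^n a_{i_1\cdots i_{d-1}j}x_j=0$ for every $(i_1,\dots,i_{d-1})\in[n]^{d-1}$ (indices not necessarily distinct); $\ker A$ is the space of null vectors, $\operatorname{null}A=\dim\ker A$, and $\mathrm{M}(H)=\max\{\operatorname{null}A: A\in\mathcal{S}(H)\}$. Zero forcing: initially the vertices of a set $B\subseteq V(H)$ are blue and all others white. Hypergraph color change rule: a set $S$ of $d-1$ distinct vertices (not required to be blue) can change a white vertex $w$ to blue if (i) $S\cup\{w\}\in E(H)$ and (ii) whenever $u$ is a white vertex with $S\cup\{u\}\in E(H)$, then $u=w$. $B$ is a zero forcing set if repeated application of this rule colors every vertex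 blue. $\mathrm{Z}_0(H)$ is the minimum cardinality of a zero forcing set of $H$. -}

module Defs where

open import Level using (Level; _⊔_) renaming (suc to lsuc)
open import Data.Nat using (ℕ; zero; suc; pred; _∸_; _≤_)
open import Data.Fin using (Fin; fromℕ; _≟_)
open import Data.Fin.Properties using (any?)
open import Data.Fin.Subset using (Subset; _∈_; _∪_; ⁅_⁆; ∣_∣)
open import Data.Fin.Permutation using (Permutation′; _⟨$⟩ʳ_)
open import Data.Vec using (tabulate)
open import Data.Vec.Functional using (insertAt)
open import Data.Product using (Σ; _×_; _,_)
open import Data.Sum using (_⊎_)
open import Algebra.Bundles using (CommutativeRing)
open import Relation.Nullary using (¬_; does)
open import Relation.Binary.PropositionalEquality using (_≡_)
open import Function using (_∘_)

record Field (c ℓ : Level) : Set (lsuc (c ⊔ ℓ)) where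
  field
    commutativeRing : CommutativeRing c ℓ
  open CommutativeRing commutativeRing public
  field
    0≉1     : ¬ (0# ≈ 1#)
    inverse : ∀ x → ¬ (x ≈ 0#) → Σ Carrier (λ y → (x * y) ≈ 1#)

record Hypergraph (n d : ℕ) : Set₁ where
  field
    Edge    : Subset n → Set
    uniform : ∀ e → Edge e → ∣ e ∣ ≡ d
open Hypergraph public

img : ∀ {d n} → (Fin d → Fin n) → Subset n
img {d} i = tabulate (λ v → does (any? (λ j → i j ≟ v)))

Distinct : ∀ {d n} → (Fin d → Fin n) → Set
Distinct {d} i = ∀ (a b : Fin d) → i a ≡ i b → a ≡ b

module _ {c ℓ} (F : Field c ℓ) where
  open Field F

  Hypermatrix : ℕ → ℕ → Set c
  Hypermatrix d n = (Fin d → Fin n) → Carrier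

  Symmetric : ∀ {d n} → Hypermatrix d n → Set ℓ
  Symmetric {d} {n} A = ∀ (π : Permutation′ d) (i : Fin d → Fin n) →
                          A (i ∘ (π ⟨$⟩ʳ_)) ≈ A i

  Graphical : ∀ {d n} → Hypermatrix d n → Set ℓ
  Graphical {d} {n} A =
    Symmetric A × (∀ (i : Fin d → Fin n) → ¬ Distinct i → A i ≈ 0#)

  InS : ∀ {n d} → Hypergraph n d → Hypermatrix d n → Set ℓ
  InS {n} {d} H A =
    Graphical A ×
    (∀ (i : Fin d → Fin n) →
       (¬ (A i ≈ 0#) → Edge H (img i)) × (Edge H (img i) → ¬ (A i ≈ 0#)))

  ∑ : ∀ {m} → (Fin m → Carrier) → Carrier
  ∑ {zero}  f = 0#
  ∑ {suc m} f = f Fin.zero + ∑ (λ j → f (Fin.suc j))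

  appendLast : ∀ {d n} → (Fin (pred d) → Fin n) → Fin n → Fin d → Fin n
  appendLast {zero}  t j ()
  appendLast {suc e} t j = insertAt t (fromℕ e) j

  IsNullVector : ∀ {d n} → Hypermatrix d n → (Fin n → Carrier) → Set ℓ
  IsNullVector {d} {n} A x =
    ∀ (t : Fin (pred d) → Fin n) → ∑ (λ j → A (appendLast t j) * x j) ≈ 0#

  LinearlyIndependent : ∀ {k n} → (Fin k → Fin n → Carrier) → Set (c ⊔ ℓ)
  LinearlyIndependent {k} {n} xs =
    ∀ (γ : Fin k → Carrier) →
      (∀ (v : Fin n) → ∑ (λ a → γ a * xs a v) ≈ 0#) →
      ∀ (a : Fin k) → γ a ≈ 0#

  NullityAtLeast : ∀ {d n} → Hypermatrix d n → ℕ → Set (c ⊔ ℓ)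
  NullityAtLeast {d} {n} A k =
    Σ (Fin k → Fin n → Carrier) λ xs →
      (∀ a → IsNullVector A (xs a)) × LinearlyIndependent xs

  MaxNullityAtMost : ∀ {n d} → Hypergraph n d → ℕ → Set (c ⊔ ℓ)
  MaxNullityAtMost {n} {d} H m =
    ∀ (A : Hypermatrix d n) → InS H A → ∀ (k : ℕ) → NullityAtLeast A k → k ≤ m

-- Blue H B v : v is eventually coloured blue starting from
-- the blue set B (least set closed under the hypergraph colour change rule:
-- a (d-1)-set S forces w when S ∪ {w} is an edge and every u with S ∪ {u}
-- an edge is either w itself or already blue).

data Blue {n d} (H : Hypergraph n d) (B : Subset n) : Fin n → Set where
  initial : ∀ {v} → v ∈ B → Blue H B v
  force   : ∀ {w} (S : Subset n) → ∣ S ∣ ≡ d ∸ 1 →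
            Edge H (S ∪ ⁅ w ⁆) →
            (∀ u → Edge H (S ∪ ⁅ u ⁆) → u ≡ w ⊎ Blue H B u) →
            Blue H B w

IsZeroForcingSet : ∀ {n d} → Hypergraph n d → Subset n → Set
IsZeroForcingSet H B = ∀ v → Blue H B v

-- Let A ∈ S(H) have k > ∣ B ∣ linearly independent null vectors. As k exceeds
-- the number of coordinates in B, some nontrivial linear combination y of them
-- vanishes on B, and y is again a null vector of A. If a (d-1)-set S forces w,
-- the null-vector equation of A at S reads Σ_u a_{S u} y_u = 0, where a_{S u} ≠ 0
-- exactly when S ∪ {u} is an edge; all such u other than w are already blue,
-- so y_w = 0. Hence y vanishes on every vertex, contradicting independence.

module Submission where

open import Defs
open import Level using (Level; _⊔_)
open import Data.Bool using (true; false)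
open import Data.Nat using (ℕ; zero; suc; _≤_; _<_; _≤?_; s≤s)
open import Data.Nat.Properties using (≰⇒>; m<n⇒m<1+n)
open import Data.Fin using (Fin; zero; suc; punchIn; punchOut; fromℕ; _≟_)
open import Data.Fin.Properties using (any?; punchIn-punchOut; punchInᵢ≢i)
open import Data.Fin.Subset using (Subset; _∈_; _∪_; ⁅_⁆; ∣_∣)
open import Data.Fin.Subset.Properties using (⊆-antisym; x∈p∪q⁻; x∈p∪q⁺; x∈⁅x⁆; x∈⁅y⁆⇒x≡y)
open import Data.Vec using ([]; _∷_; here; there)
open import Data.Vec.Properties using (lookup∘tabulate; []=⇒lookup; lookup⇒[]=)
open import Data.Vec.Functional using (insertAt)
open import Data.Vec.Functional.Properties using (insertAt-lookup; insertAt-punchIn)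
open import Data.Product using (Σ; ∃; _×_; _,_; proj₁; proj₂)
open import Data.Sum using (_⊎_; inj₁; inj₂)
open import Data.Empty using (⊥-elim)
open import Function using (_∘_)
open import Relation.Nullary using (¬_; yes; no)
open import Relation.Nullary.Decidable using (dec-true; ¬¬-excluded-middle)
open import Relation.Nullary.Negation using (contradiction; ¬¬-map; negated-stable)
open import Relation.Binary.PropositionalEquality as ≡ using (_≡_; refl; subst; cong)
import Algebra.Properties.Semiring.Sum as SemiringSum

-- Equality in a field need not be decidable, so every case split on
-- "x ≈ 0#" or on "S ∪ ⁅ j ⁆ is an edge" is done under a double negation.
-- This is harmless: the theorem is an inequality between natural numbers,
-- which is stable under double negation.

_>>=_ : ∀ {a b} {A : Set a} {B : Set b} → ¬ ¬ A → (A → ¬ ¬ B) → ¬ ¬ B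
¬¬a >>= f = negated-stable (¬¬-map f ¬¬a)

¬¬-∀-Fin : ∀ {a m} {P : Fin m → Set a} → (∀ i → ¬ ¬ P i) → ¬ ¬ (∀ i → P i)
¬¬-∀-Fin {m = zero}  ¬¬P ¬∀P = ¬∀P λ ()
¬¬-∀-Fin {m = suc m} ¬¬P ¬∀P = ¬¬P zero λ P₀ →
  ¬¬-∀-Fin (¬¬P ∘ suc) λ P₊ → ¬∀P λ { zero → P₀ ; (suc i) → P₊ i }

¬¬-∀⊎∃¬-Fin : ∀ {a m} {P : Fin m → Set a} → ¬ ¬ ((∀ i → P i) ⊎ ∃ λ i → ¬ P i)
¬¬-∀⊎∃¬-Fin ¬∀⊎∃¬ = ¬¬-∀-Fin (λ i ¬Pi → ¬∀⊎∃¬ (inj₂ (i , ¬Pi))) (¬∀⊎∃¬ ∘ inj₁)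

module _ {d n : ℕ} (i : Fin d → Fin n) where

  ∈-img⁺ : ∀ k → i k ∈ img i
  ∈-img⁺ k = lookup⇒[]= (i k) _
    (≡.trans (lookup∘tabulate _ (i k)) (dec-true (any? λ j → i j ≟ i k) (k , refl)))

  ∈-img⁻ : ∀ {v} → v ∈ img i → ∃ λ k → i k ≡ v
  ∈-img⁻ {v} v∈ with any? (λ k → i k ≟ v) | ≡.trans (≡.sym (lookup∘tabulate _ v)) ([]=⇒lookup v∈)
  ... | yes found | _  = found
  ... | no _      | ()

img-insertAt : ∀ {m n} (t : Fin m → Fin n) (i : Fin (suc m)) (j : Fin n) →
               img (insertAt t i j) ≡ img t ∪ ⁅ j ⁆
img-insertAt t i j = ⊆-antisym ⊆ ⊇
  where
  ⊆ : ∀ {v} → v ∈ img (insertAt t i j) → v ∈ img t ∪ ⁅ j ⁆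
  ⊆ v∈ with ∈-img⁻ (insertAt t i j) v∈
  ... | k , refl with i ≟ k
  ... | yes refl = x∈p∪q⁺ (inj₂ (subst (_∈ ⁅ j ⁆) (≡.sym (insertAt-lookup t i j)) (x∈⁅x⁆ j)))
  ... | no i≢k   = x∈p∪q⁺ (inj₁ (subst (_∈ img t)
    (≡.trans (≡.sym (insertAt-punchIn t i j (punchOut i≢k))) (cong (insertAt t i j) (punchIn-punchOut i≢k)))
    (∈-img⁺ t (punchOut i≢k))))
  ⊇ : ∀ {v} → v ∈ img t ∪ ⁅ j ⁆ → v ∈ img (insertAt t i j)
  ⊇ v∈ with x∈p∪q⁻ (img t) ⁅ j ⁆ v∈
  ... | inj₁ v∈t with ∈-img⁻ t v∈t
  ... | k , refl = subst (_∈ img (insertAt t i j)) (insertAt-punchIn t i j k)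
                         (∈-img⁺ (insertAt t i j) (punchIn i k))
  ⊇ v∈ | inj₂ v∈j rewrite x∈⁅y⁆⇒x≡y j v∈j =
    subst (_∈ img (insertAt t i j)) (insertAt-lookup t i j) (∈-img⁺ (insertAt t i j) i)

Enumerates : ∀ {m n} → (Fin m → Fin n) → Subset n → Set
Enumerates t S = (∀ k → t k ∈ S) × (∀ {v} → v ∈ S → ∃ λ k → t k ≡ v)

enumerate : ∀ {n} (S : Subset n) → Σ (Fin ∣ S ∣ → Fin n) λ t → Enumerates t S
enumerate []          = (λ ()) , (λ ()) , λ ()
enumerate (b ∷ S) with enumerate S
enumerate (true ∷ S) | t , t∈S , S⊆t = t′ , t′∈ , ⊆t′
  where
  t′ : Fin (suc ∣ S ∣) → Fin _
  t′ zero    = zero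
  t′ (suc k) = suc (t k)
  t′∈ : ∀ k → t′ k ∈ (true ∷ S)
  t′∈ zero    = here
  t′∈ (suc k) = there (t∈S k)
  ⊆t′ : ∀ {v} → v ∈ (true ∷ S) → ∃ λ k → t′ k ≡ v
  ⊆t′ here = zero , refl
  ⊆t′ (there v∈S) with S⊆t v∈S
  ... | k , refl = suc k , refl
enumerate (false ∷ S) | t , t∈S , S⊆t = suc ∘ t , there ∘ t∈S , ⊆t′
  where
  ⊆t′ : ∀ {v} → v ∈ (false ∷ S) → ∃ λ k → suc (t k) ≡ v
  ⊆t′ (there v∈S) with S⊆t v∈S
  ... | k , refl = k , refl

img-enumeration : ∀ {m n} {t : Fin m → Fin n} {S : Subset n} → Enumerates t S → img t ≡ S
img-enumeration {t = t} (t∈S , S⊆t) = ⊆-antisym ⊆ ⊇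
  where
  ⊆ : ∀ {v} → v ∈ img t → v ∈ _
  ⊆ v∈ with ∈-img⁻ t v∈
  ... | k , refl = t∈S k
  ⊇ : ∀ {v} → v ∈ _ → v ∈ img t
  ⊇ v∈ with S⊆t v∈
  ... | k , refl = ∈-img⁺ t k

module FieldLinearAlgebra {c ℓ} (F : Field c ℓ) where

  open Field F hiding (zero) renaming (refl to ≈-refl)
  open SemiringSum semiring using (sum; sum-remove) renaming (∑-distrib-+ to sum-distrib-+)
  open import Algebra.Properties.Ring ring using (-‿distribˡ-*)
  open import Algebra.Properties.CommutativeSemigroup *-commutativeSemigroup using (x∙yz≈y∙xz)
  open import Relation.Binary.Reasoning.Setoid setoid

  ∑′ : ∀ {m} → (Fin m → Carrier) → Carrier
  ∑′ = ∑ F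

  ∑≈sum : ∀ {m} (f : Fin m → Carrier) → ∑′ f ≈ sum f
  ∑≈sum {zero}  f = ≈-refl
  ∑≈sum {suc m} f = +-congˡ (∑≈sum (f ∘ suc))

  ∑-cong : ∀ {m} {f g : Fin m → Carrier} → (∀ i → f i ≈ g i) → ∑′ f ≈ ∑′ g
  ∑-cong {zero}  f≈g = ≈-refl
  ∑-cong {suc m} f≈g = +-cong (f≈g zero) (∑-cong (f≈g ∘ suc))

  ∑-zero : ∀ {m} {f : Fin m → Carrier} → (∀ i → f i ≈ 0#) → ∑′ f ≈ 0#
  ∑-zero {zero}  f≈0 = ≈-refl
  ∑-zero {suc m} f≈0 = trans (+-cong (f≈0 zero) (∑-zero (f≈0 ∘ suc))) (+-identityˡ 0#)

  ∑-distrib-+ : ∀ {m} (f g : Fin m → Carrier) → ∑′ (λ i → f i + g i) ≈ ∑′ f + ∑′ g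
  ∑-distrib-+ f g = begin
    ∑′ (λ i → f i + g i)  ≈⟨ ∑≈sum (λ i → f i + g i) ⟩
    sum (λ i → f i + g i) ≈⟨ sum-distrib-+ f g ⟩
    sum f + sum g         ≈⟨ +-cong (∑≈sum f) (∑≈sum g) ⟨
    ∑′ f + ∑′ g           ∎

  ∑-remove : ∀ {m} (f : Fin (suc m) → Carrier) (i : Fin (suc m)) → ∑′ f ≈ f i + ∑′ (f ∘ punchIn i)
  ∑-remove f i = begin
    ∑′ f                      ≈⟨ ∑≈sum f ⟩
    sum f                     ≈⟨ sum-remove f ⟩
    f i + sum (f ∘ punchIn i) ≈⟨ +-congˡ (∑≈sum (f ∘ punchIn i)) ⟨
    f i + ∑′ (f ∘ punchIn i)  ∎

  ∑-comm : ∀ {m n} (f : Fin m → Fin n → Carrier) → ∑′ (λ i → ∑′ (f i)) ≈ ∑′ (λ j → ∑′ (λ i → f i j))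
  ∑-comm {zero} {n} f = sym (∑-zero {n} λ _ → ≈-refl)
  ∑-comm {suc m} f = trans (+-congˡ (∑-comm (f ∘ suc))) (sym (∑-distrib-+ (f zero) _))

  *-distribˡ-∑ : ∀ {m} x (f : Fin m → Carrier) → x * ∑′ f ≈ ∑′ (λ i → x * f i)
  *-distribˡ-∑ {zero}  x f = zeroʳ x
  *-distribˡ-∑ {suc m} x f = trans (distribˡ x _ _) (+-congˡ (*-distribˡ-∑ x (f ∘ suc)))

  *-distribʳ-∑ : ∀ {m} x (f : Fin m → Carrier) → ∑′ f * x ≈ ∑′ (λ i → f i * x)
  *-distribʳ-∑ {zero}  x f = zeroˡ x
  *-distribʳ-∑ {suc m} x f = trans (distribʳ x _ _) (+-congˡ (*-distribʳ-∑ x (f ∘ suc)))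

  ∑-single : ∀ {m} (f : Fin m → Carrier) (w : Fin m) → (∀ j → j ≡ w ⊎ f j ≈ 0#) → ∑′ f ≈ f w
  ∑-single {suc m} f w off-w≈0 = begin
    ∑′ f                     ≈⟨ ∑-remove f w ⟩
    f w + ∑′ (f ∘ punchIn w) ≈⟨ +-congˡ (∑-zero off-w) ⟩
    f w + 0#                 ≈⟨ +-identityʳ (f w) ⟩
    f w                      ∎
    where
    off-w : ∀ k → f (punchIn w k) ≈ 0#
    off-w k with off-w≈0 (punchIn w k)
    ... | inj₁ wₖ≡w = contradiction wₖ≡w (punchInᵢ≢i w k)
    ... | inj₂ fₖ≈0 = fₖ≈0

  *-zero-cancelˡ : ∀ {x y} → x ≉ 0# → x * y ≈ 0# → y ≈ 0#
  *-zero-cancelˡ {x} {y} x≉0 xy≈0 with inverse x x≉0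
  ... | x⁻¹ , xx⁻¹≈1 = begin
    y              ≈⟨ *-identityˡ y ⟨
    1# * y         ≈⟨ *-congʳ (trans (sym xx⁻¹≈1) (*-comm x x⁻¹)) ⟩
    x⁻¹ * x * y    ≈⟨ *-assoc x⁻¹ x y ⟩
    x⁻¹ * (x * y)  ≈⟨ *-congˡ xy≈0 ⟩
    x⁻¹ * 0#       ≈⟨ zeroʳ x⁻¹ ⟩
    0#             ∎

  combination : ∀ {k p} → (Fin k → Carrier) → (Fin k → Fin p → Carrier) → Fin p → Carrier
  combination γ xs v = ∑′ (λ a → γ a * xs a v)

  NonTrivial : ∀ {k} → (Fin k → Carrier) → Set ℓ
  NonTrivial γ = ∃ λ a → γ a ≉ 0#

  Dependent : ∀ {k p} → (Fin k → Fin p → Carrier) → Set (c ⊔ ℓ)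
  Dependent {k} xs = Σ (Fin k → Carrier) λ γ → NonTrivial γ × (∀ i → combination γ xs i ≈ 0#)

  -- One step of Gaussian elimination: clear the first coordinate of the other
  -- vectors using the pivot vector xs a₀; a dependency among the reduced vectors
  -- lifts to one among xs.
  module PivotElimination {k p} (xs : Fin (suc k) → Fin (suc p) → Carrier)
                          (a₀ : Fin (suc k)) (pivot≉0 : xs a₀ zero ≉ 0#) where

    pivot⁻¹ : Carrier
    pivot⁻¹ = proj₁ (inverse (xs a₀ zero) pivot≉0)

    others : Fin k → Fin (suc p) → Carrier
    others b = xs (punchIn a₀ b)

    factor : Fin k → Carrier
    factor b = - (others b zero * pivot⁻¹)

    reduced : Fin k → Fin (suc p) → Carrier
    reduced b v = others b v + factor b * xs a₀ v

    reduced-head≈0 : ∀ b → reduced b zero ≈ 0#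
    reduced-head≈0 b = begin
      x + - (x * pivot⁻¹) * xs a₀ zero    ≈⟨ +-congˡ (-‿distribˡ-* (x * pivot⁻¹) (xs a₀ zero)) ⟨
      x + - (x * pivot⁻¹ * xs a₀ zero)    ≈⟨ +-congˡ (-‿cong (*-assoc x pivot⁻¹ (xs a₀ zero))) ⟩
      x + - (x * (pivot⁻¹ * xs a₀ zero))  ≈⟨ +-congˡ (-‿cong (*-congˡ (trans (*-comm _ _) pivot*pivot⁻¹≈1))) ⟩
      x + - (x * 1#)                      ≈⟨ +-congˡ (-‿cong (*-identityʳ x)) ⟩
      x + - x                             ≈⟨ -‿inverseʳ x ⟩
      0#                                  ∎
      where
      x : Carrier
      x = others b zero
      pivot*pivot⁻¹≈1 : xs a₀ zero * pivot⁻¹ ≈ 1#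
      pivot*pivot⁻¹≈1 = proj₂ (inverse (xs a₀ zero) pivot≉0)

    lift : (Fin k → Carrier) → Fin (suc k) → Carrier
    lift δ = insertAt δ a₀ (∑′ λ b → δ b * factor b)

    combination-lift : ∀ δ v → combination (lift δ) xs v ≈ combination δ reduced v
    combination-lift δ v = begin
      combination (lift δ) xs v
        ≈⟨ ∑-remove (λ a → lift δ a * xs a v) a₀ ⟩
      lift δ a₀ * xs a₀ v + ∑′ (λ b → lift δ (punchIn a₀ b) * others b v)
        ≈⟨ +-cong (*-congʳ (reflexive (insertAt-lookup δ a₀ γ₀)))
                  (∑-cong λ b → *-congʳ (reflexive (insertAt-punchIn δ a₀ γ₀ b))) ⟩
      γ₀ * xs a₀ v + ∑′ (λ b → δ b * others b v)
        ≈⟨ +-comm _ _ ⟩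
      ∑′ (λ b → δ b * others b v) + γ₀ * xs a₀ v
        ≈⟨ +-congˡ (*-distribʳ-∑ (xs a₀ v) (λ b → δ b * factor b)) ⟩
      ∑′ (λ b → δ b * others b v) + ∑′ (λ b → δ b * factor b * xs a₀ v)
        ≈⟨ ∑-distrib-+ (λ b → δ b * others b v) (λ b → δ b * factor b * xs a₀ v) ⟨
      ∑′ (λ b → δ b * others b v + δ b * factor b * xs a₀ v)
        ≈⟨ ∑-cong {k} (λ b → trans (+-congˡ (*-assoc _ _ _)) (sym (distribˡ _ _ _))) ⟩
      combination δ reduced v ∎
      where
      γ₀ : Carrier
      γ₀ = ∑′ λ b → δ b * factor b

    dependent-lift : Dependent (λ b i → reduced b (suc i)) → Dependent xs
    dependent-lift (δ , (b , δb≉0) , δ-tail≈0) = lift δ , (punchIn a₀ b , lift-b≉0) , lift≈0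
      where
      lift-b≉0 : lift δ (punchIn a₀ b) ≉ 0#
      lift-b≉0 rewrite insertAt-punchIn δ a₀ (∑′ λ b → δ b * factor b) b = δb≉0
      lift≈0 : ∀ i → combination (lift δ) xs i ≈ 0#
      lift≈0 zero    = trans (combination-lift δ zero)
                             (∑-zero λ b → trans (*-congˡ (reduced-head≈0 b)) (zeroʳ (δ b)))
      lift≈0 (suc i) = trans (combination-lift δ (suc i)) (δ-tail≈0 i)

  ¬¬-dependent : ∀ {k p} (xs : Fin k → Fin p → Carrier) → p < k → ¬ ¬ Dependent xs
  ¬¬-dependent {suc k} {zero}  xs _ = contradiction ((λ _ → 1#) , (zero , 0≉1 ∘ sym) , λ ())
  ¬¬-dependent {suc k} {suc p} xs (s≤s p<k) = ¬¬-∀⊎∃¬-Fin >>= λ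
    { (inj₁ head≈0) → ¬¬-map (extend head≈0) (¬¬-dependent (λ a i → xs a (suc i)) (m<n⇒m<1+n p<k))
    ; (inj₂ (a₀ , pivot≉0)) → ¬¬-map (PivotElimination.dependent-lift xs a₀ pivot≉0)
                                     (¬¬-dependent _ p<k)
    }
    where
    extend : (∀ a → xs a zero ≈ 0#) → Dependent (λ a i → xs a (suc i)) → Dependent xs
    extend head≈0 (γ , γ≢0 , tail≈0) = γ , γ≢0 , λ where
      zero    → ∑-zero λ a → trans (*-congˡ (head≈0 a)) (zeroʳ (γ a))
      (suc i) → tail≈0 i

  combination-isNullVector : ∀ {d k n} {A : Hypermatrix F d n} (γ : Fin k → Carrier)
                             (xs : Fin k → Fin n → Carrier) →
                             (∀ a → IsNullVector F A (xs a)) → IsNullVector F A (combination γ xs)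
  combination-isNullVector {k = k} {n} {A} γ xs xs-null t = begin
    ∑′ (λ j → Aₜ j * ∑′ (λ a → γ a * xs a j))
      ≈⟨ ∑-cong {n} (λ j → *-distribˡ-∑ (Aₜ j) (λ a → γ a * xs a j)) ⟩
    ∑′ (λ j → ∑′ (λ a → Aₜ j * (γ a * xs a j)))
      ≈⟨ ∑-comm {n} {k} _ ⟩
    ∑′ (λ a → ∑′ (λ j → Aₜ j * (γ a * xs a j)))
      ≈⟨ ∑-cong {k} (λ a → ∑-cong {n} (λ j → x∙yz≈y∙xz (Aₜ j) (γ a) (xs a j))) ⟩
    ∑′ (λ a → ∑′ (λ j → γ a * (Aₜ j * xs a j)))
      ≈⟨ ∑-cong {k} (λ a → *-distribˡ-∑ (γ a) (λ j → Aₜ j * xs a j)) ⟨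
    ∑′ (λ a → γ a * ∑′ (λ j → Aₜ j * xs a j))
      ≈⟨ ∑-zero (λ a → trans (*-congˡ (xs-null a t)) (zeroʳ (γ a))) ⟩
    0# ∎
    where
    Aₜ : Fin n → Carrier
    Aₜ j = A (appendLast F t j)

module ZeroForcing {c ℓ} (F : Field c ℓ) {n e : ℕ} (H : Hypergraph n (suc e))
                   {A : Hypermatrix F (suc e) n} (A∈S : InS F H A)
                   {y : Fin n → Field.Carrier F} (y-null : IsNullVector F A y)
                   {B : Subset n} (y-B : ∀ {v} → v ∈ B → Field._≈_ F (y v) (Field.0# F)) where

  open Field F hiding (zero)
  open FieldLinearAlgebra F using (∑-single; *-zero-cancelˡ)

  edge⇒entry≉0 : ∀ i → Edge H (img i) → A i ≉ 0#
  edge⇒entry≉0 i = proj₂ (proj₂ A∈S i)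

  ¬edge⇒¬¬entry≈0 : ∀ i → ¬ Edge H (img i) → ¬ ¬ (A i ≈ 0#)
  ¬edge⇒¬¬entry≈0 i ¬edge A≉0 = ¬edge (proj₁ (proj₂ A∈S i) A≉0)

  blue⇒¬¬vanishes : ∀ {v} → Blue H B v → ¬ ¬ (y v ≈ 0#)
  blue⇒¬¬vanishes (initial v∈B) = contradiction (y-B v∈B)
  blue⇒¬¬vanishes (force {w} S ∣S∣≡e S∪w-edge forced) = ¬¬-map yw≈0 (¬¬-∀-Fin term≈0)
    where
    enumeration : Σ (Fin e → Fin n) λ t → Enumerates t S
    enumeration = subst (λ m → Σ (Fin m → Fin n) λ t → Enumerates t S) ∣S∣≡e (enumerate S)

    t : Fin e → Fin n
    t = proj₁ enumeration

    tuple : Fin n → Fin (suc e) → Fin n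
    tuple = appendLast F t

    img-tuple : ∀ j → img (tuple j) ≡ S ∪ ⁅ j ⁆
    img-tuple j = ≡.trans (img-insertAt t (fromℕ e) j)
                          (cong (_∪ ⁅ j ⁆) (img-enumeration (proj₂ enumeration)))

    term : Fin n → Carrier
    term j = A (tuple j) * y j

    term≈0 : ∀ j → ¬ ¬ (j ≡ w ⊎ term j ≈ 0#)
    term≈0 j = ¬¬-excluded-middle >>= λ
      { (yes S∪j-edge) → case-forced (forced j S∪j-edge)
      ; (no ¬S∪j-edge) → ¬¬-map (λ A≈0 → inj₂ (trans (*-congʳ A≈0) (zeroˡ (y j))))
          (¬edge⇒¬¬entry≈0 (tuple j) (¬S∪j-edge ∘ subst (Edge H) (img-tuple j)))
      }
      where
      case-forced : j ≡ w ⊎ Blue H B j → ¬ ¬ (j ≡ w ⊎ term j ≈ 0#)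
      case-forced (inj₁ j≡w)    = contradiction (inj₁ j≡w)
      case-forced (inj₂ j-blue) = ¬¬-map (λ yj≈0 → inj₂ (trans (*-congˡ yj≈0) (zeroʳ _)))
                                         (blue⇒¬¬vanishes j-blue)

    yw≈0 : (∀ j → j ≡ w ⊎ term j ≈ 0#) → y w ≈ 0#
    yw≈0 others≈0 = *-zero-cancelˡ
      (edge⇒entry≉0 (tuple w) (subst (Edge H) (≡.sym (img-tuple w)) S∪w-edge))
      (trans (sym (∑-single term w others≈0)) (y-null t))

theorem1p8 : ∀ {c ℓ : Level} (F : Field c ℓ) (n d : ℕ) → 2 ≤ d → d ≤ n →
               (H : Hypergraph n d) (B : Subset n) → IsZeroForcingSet H B →
               MaxNullityAtMost F H ∣ B ∣
theorem1p8 F n zero ()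
theorem1p8 F n (suc e) _ _ H B B-forces A A∈S k (xs , xs-null , xs-independent) with k ≤? ∣ B ∣
... | yes k≤∣B∣ = k≤∣B∣
... | no  k≰∣B∣ = ⊥-elim (¬¬-dependent (λ a i → xs a (tB i)) (≰⇒> k≰∣B∣) ¬dependent-on-B)
  where
  open Field F hiding (zero)
  open FieldLinearAlgebra F
  tB : Fin ∣ B ∣ → Fin n
  tB = proj₁ (enumerate B)

  ¬dependent-on-B : ¬ Dependent (λ a i → xs a (tB i))
  ¬dependent-on-B (γ , (a , γa≉0) , γ-B≈0) =
    ¬¬-∀-Fin (λ v → blue⇒¬¬vanishes (B-forces v)) (λ y≈0 → γa≉0 (xs-independent γ y≈0 a))
    where
    y-B : ∀ {v} → v ∈ B → combination γ xs v ≈ 0#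
    y-B v∈B with proj₂ (proj₂ (enumerate B)) v∈B
    ... | i , refl = γ-B≈0 i
    open ZeroForcing F H A∈S (combination-isNullVector {A = A} γ xs xs-null) y-B
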